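{- For all $n\in\mathbb{N}$ and $x\in\mathbb{C}$, \[ \sum_{k=1}^{n}\binom{n}{k}\left[H_k^2+H_k^{(2)}\right]x^k=(1+x)^n\left[H_n^2+H_n^{(2)}+2\sum_{k=1}^{n}\frac{H_{k-1}-H_n}{k(1+x)^k}\right]. \]
   Context: For $m\in\mathbb{N}_0$, $H_m^{(r)}=\sum_{j=1}^{m}\frac{1}{j^r}$ (with $H_0^{(r)}=0$) and $H_m=H_m^{(1)}$. For $1\le k\le n$ the quotient $(1+x)^n/(1+x)^k$ is understood as the polynomial $(1+x)^{n-k}$, so the identity is meaningful for all $x\in\mathbb{C}$, including $x=-1$. -}

module Defs where

open import Level using (Level)
open import Data.Nat as ℕ using (ℕ; zero; suc; _∸_)
open import Data.Nat.Properties using (m^n≢0)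
open import Data.Nat.Combinatorics using (_C_)
open import Data.Integer using (+_)
open import Data.Rational as ℚ using (ℚ; _/_)
open import Algebra.Bundles using (CommutativeRing)

H^ : ℕ → ℕ → ℚ
H^ r zero = ℚ.0ℚ
H^ r (suc m) = H^ r m ℚ.+ ((+ 1) / (suc m ℕ.^ r)) {{m^n≢0 (suc m) r}}

H : ℕ → ℚ
H m = H^ 1 m

inv : (k : ℕ) → ℚ
inv zero = ℚ.0ℚ   -- never used (only k ≥ 1 occurs)
inv (suc k) = (+ 1) / suc k

module _ {c ℓ : Level} (R : CommutativeRing c ℓ) where
  open CommutativeRing R

  pow : Carrier → ℕ → Carrier
  pow x zero = 1#
  pow x (suc n) = x * pow x n

  sum1 : ℕ → (ℕ → Carrier) → Carrier
  sum1 zero f = 0#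
  sum1 (suc n) f = sum1 n f + f (suc n)

ℕtoℚ : ℕ → ℚ
ℕtoℚ m = (+ m) / 1

-- Write T g m = Σ_{k=1}^m C(m,k) g_k x^k. Pascal's rule gives
--   T g (m+1) = (1+x) T g m + x g_0 + Σ_{k=1}^{m+1} C(m,k-1) (g_k - g_{k-1}) x^k,
-- and the absorption identity C(m,k-1)/k = C(m+1,k)/(m+1) turns the last sum into T d (m+1)/(m+1)
-- whenever g_k - g_{k-1} = d_k/k. As H_k - H_{k-1} = 1/k and the differences of H_k² + H_k^{(2)}
-- are 2H_k/k, induction on m gives in turn T 1 m = (1+x)^m - 1,
-- T H m = H_m (1+x)^m - Σ_{k=1}^m (1+x)^{m-k}/k, and the theorem.
module Submission where

open import Defs
open import Level using (Level)
open import Data.Nat as ℕ using (ℕ; zero; suc; _∸_; _<_)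
import Data.Nat.Properties as ℕ
open import Data.Nat.Combinatorics using (_C_; nC1≡n; k>n⇒nCk≡0; nCk+nC[k+1]≡[n+1]C[k+1])
open import Data.Integer using (+_)
import Data.Integer.Solver as ℤ-Solver
open import Data.Rational as ℚ using (ℚ; _/_; toℚᵘ)
open import Data.Rational.Properties
  using (+-*-rawRing; /-cong; toℚᵘ-injective; toℚᵘ-fromℚᵘ; toℚᵘ-homo-+; toℚᵘ-homo-*)
open import Data.Rational.Unnormalised as ℚᵘ using (mkℚᵘ; _≃_; *≡*)
import Data.Rational.Unnormalised.Properties as ℚᵘ
open import Algebra.Bundles using (CommutativeRing)
open import Algebra.Morphism.Structures using (IsRingHomomorphism)
import Relation.Binary.PropositionalEquality as ≡
open ≡ using (_≡_; cong)

[k+1]*[n+1]C[k+1]≡[n+1]*nCk : ∀ n k → suc k ℕ.* (suc n C suc k) ≡ suc n ℕ.* (n C k)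
[k+1]*[n+1]C[k+1]≡[n+1]*nCk n zero = begin
  1 ℕ.* (suc n C 1) ≡⟨ ℕ.*-identityˡ _ ⟩
  suc n C 1         ≡⟨ nC1≡n (suc n) ⟩
  suc n             ≡⟨ ℕ.*-identityʳ (suc n) ⟨
  suc n ℕ.* 1       ∎
  where open ≡.≡-Reasoning
[k+1]*[n+1]C[k+1]≡[n+1]*nCk zero (suc k) = ℕ.*-zeroʳ (2 ℕ.+ k)
[k+1]*[n+1]C[k+1]≡[n+1]*nCk (suc n) (suc k) = begin
  (2 ℕ.+ k) ℕ.* (suc (suc n) C suc (suc k))
    ≡⟨ cong ((2 ℕ.+ k) ℕ.*_) (nCk+nC[k+1]≡[n+1]C[k+1] (suc n) (suc k)) ⟨
  (2 ℕ.+ k) ℕ.* (a ℕ.+ b)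
    ≡⟨ solve 3 (λ k a b → (con 2 :+ k) :* (a :+ b) := a :+ ((con 1 :+ k) :* a :+ (con 2 :+ k) :* b)) ≡.refl k a b ⟩
  a ℕ.+ (suc k ℕ.* a ℕ.+ (2 ℕ.+ k) ℕ.* b)
    ≡⟨ cong (a ℕ.+_) (≡.cong₂ ℕ._+_ ([k+1]*[n+1]C[k+1]≡[n+1]*nCk n k) ([k+1]*[n+1]C[k+1]≡[n+1]*nCk n (suc k))) ⟩
  a ℕ.+ (suc n ℕ.* (n C k) ℕ.+ suc n ℕ.* (n C suc k))
    ≡⟨ cong (a ℕ.+_) (ℕ.*-distribˡ-+ (suc n) (n C k) (n C suc k)) ⟨
  a ℕ.+ suc n ℕ.* (n C k ℕ.+ n C suc k)
    ≡⟨ cong (λ c → a ℕ.+ suc n ℕ.* c) (nCk+nC[k+1]≡[n+1]C[k+1] n k) ⟩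
  (2 ℕ.+ n) ℕ.* a ∎
  where
  open ≡.≡-Reasoning
  open import Data.Nat.Solver using (module +-*-Solver)
  open +-*-Solver
  a = suc n C suc k
  b = suc n C suc (suc k)

toℚᵘ-/ : ∀ n d → toℚᵘ (n / suc d) ≃ mkℚᵘ n d
toℚᵘ-/ n d = toℚᵘ-fromℚᵘ (mkℚᵘ n d)

ℕtoℚ-suc : ∀ m → ℕtoℚ (suc m) ≡ ℚ.1ℚ ℚ.+ ℕtoℚ m
ℕtoℚ-suc m = toℚᵘ-injective (begin
  toℚᵘ (ℕtoℚ (suc m))                    ≈⟨ toℚᵘ-/ (+ suc m) 0 ⟩
  mkℚᵘ (+ suc m) 0                       ≈⟨ *≡* (solve 1 (λ m → (con (+ 1) :+ m) :* (con (+ 1) :* con (+ 1))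
                                                       := (con (+ 1) :* con (+ 1) :+ m :* con (+ 1)) :* con (+ 1)) ≡.refl (+ m)) ⟩
  mkℚᵘ (+ 1) 0 ℚᵘ.+ mkℚᵘ (+ m) 0         ≈⟨ ℚᵘ.+-cong (toℚᵘ-/ (+ 1) 0) (toℚᵘ-/ (+ m) 0) ⟨
  toℚᵘ ℚ.1ℚ ℚᵘ.+ toℚᵘ (ℕtoℚ m)            ≈⟨ toℚᵘ-homo-+ ℚ.1ℚ (ℕtoℚ m) ⟨
  toℚᵘ (ℚ.1ℚ ℚ.+ ℕtoℚ m)                 ∎)
  where
  open ℚᵘ.≃-Reasoning
  open ℤ-Solver.+-*-Solver

1/[1+d]*[1+d]≡1 : ∀ d → ((+ 1) / suc d) ℚ.* ℕtoℚ (suc d) ≡ ℚ.1ℚ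
1/[1+d]*[1+d]≡1 d = toℚᵘ-injective (begin
  toℚᵘ ((+ 1) / suc d ℚ.* ℕtoℚ (suc d))            ≈⟨ toℚᵘ-homo-* ((+ 1) / suc d) (ℕtoℚ (suc d)) ⟩
  toℚᵘ ((+ 1) / suc d) ℚᵘ.* toℚᵘ (ℕtoℚ (suc d))    ≈⟨ ℚᵘ.*-cong (toℚᵘ-/ (+ 1) d) (toℚᵘ-/ (+ suc d) 0) ⟩
  mkℚᵘ (+ 1) d ℚᵘ.* mkℚᵘ (+ suc d) 0              ≈⟨ *≡* (solve 1 (λ d → (con (+ 1) :* (con (+ 1) :+ d)) :* con (+ 1)
                                                              := con (+ 1) :* ((con (+ 1) :+ d) :* con (+ 1))) ≡.refl (+ d)) ⟩
  toℚᵘ ℚ.1ℚ                                        ∎)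
  where
  open ℚᵘ.≃-Reasoning
  open ℤ-Solver.+-*-Solver

H-suc : ∀ m → H (suc m) ≡ H m ℚ.+ inv (suc m)
H-suc m = cong (H m ℚ.+_) (/-cong {+ 1} ≡.refl (ℕ.*-identityʳ (suc m)))

H²-suc : ∀ m → H^ 2 (suc m) ≡ H^ 2 m ℚ.+ (+ 1) / (suc m ℕ.* suc m)
H²-suc m = cong (H^ 2 m ℚ.+_) (/-cong {+ 1} ≡.refl (cong (suc m ℕ.*_) (ℕ.*-identityʳ (suc m))))

module _ {c ℓ : Level} (R : CommutativeRing c ℓ) where
  open CommutativeRing R
  open import Relation.Binary.Reasoning.Setoid setoid
  open import Algebra.Properties.CommutativeSemigroup +-commutativeSemigroup
    using (interchange; x∙yz≈xz∙y)
  open import Algebra.Properties.CommutativeSemigroup *-commutativeSemigroup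
    using (x∙yz≈y∙xz)
  open import Algebra.Properties.Group +-group using (//-rightDividesˡ)
  open import Algebra.Properties.Ring ring using (-‿distribˡ-*)
  open import Algebra.Properties.Semiring.Mult semiring using (_×_; ×-homo-+)

  sum1-cong-on : ∀ N {f g : ℕ → Carrier} → (∀ j → j < N → f (suc j) ≈ g (suc j)) →
                 sum1 R N f ≈ sum1 R N g
  sum1-cong-on zero    f≈g = refl
  sum1-cong-on (suc N) f≈g = +-cong (sum1-cong-on N (λ j j<N → f≈g j (ℕ.m<n⇒m<1+n j<N))) (f≈g N ℕ.≤-refl)

  sum1-cong : ∀ N {f g : ℕ → Carrier} → (∀ k → f k ≈ g k) → sum1 R N f ≈ sum1 R N g
  sum1-cong N f≈g = sum1-cong-on N (λ j _ → f≈g (suc j))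

  sum1-+ : ∀ N (f g : ℕ → Carrier) → sum1 R N (λ k → f k + g k) ≈ sum1 R N f + sum1 R N g
  sum1-+ zero    f g = sym (+-identityˡ 0#)
  sum1-+ (suc N) f g = trans (+-congʳ (sum1-+ N f g)) (interchange _ _ _ _)

  sum1-*ˡ : ∀ N (z : Carrier) (f : ℕ → Carrier) → sum1 R N (λ k → z * f k) ≈ z * sum1 R N f
  sum1-*ˡ zero    z f = sym (zeroʳ z)
  sum1-*ˡ (suc N) z f = trans (+-congʳ (sum1-*ˡ N z f)) (sym (distribˡ z _ _))

  sum1-suc-first : ∀ N (f : ℕ → Carrier) → sum1 R (suc N) f ≈ f 1 + sum1 R N (λ j → f (suc j))
  sum1-suc-first zero    f = +-comm 0# (f 1)
  sum1-suc-first (suc N) f = trans (+-congʳ (sum1-suc-first N f)) (+-assoc _ _ _)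

  horner : Carrier → (ℕ → Carrier) → ℕ → Carrier
  horner y f m = sum1 R m (λ k → f k * pow R y (m ∸ k))

  horner-suc : ∀ y f m → horner y f (suc m) ≈ y * horner y f m + f (suc m)
  horner-suc y f m = +-cong (begin
    sum1 R m (λ k → f k * pow R y (suc m ∸ k))   ≈⟨ sum1-cong-on m (λ j j<m → *-congˡ (pow-suc-∸ j<m)) ⟩
    sum1 R m (λ k → f k * (y * pow R y (m ∸ k))) ≈⟨ sum1-cong m (λ k → x∙yz≈y∙xz (f k) y _) ⟩
    sum1 R m (λ k → y * (f k * pow R y (m ∸ k))) ≈⟨ sum1-*ˡ m y _ ⟩
    y * horner y f m                              ∎)
    (trans (*-congˡ (reflexive (cong (pow R y) (ℕ.n∸n≡0 m)))) (*-identityʳ _))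
    where
    pow-suc-∸ : ∀ {j} → j < m → pow R y (suc m ∸ suc j) ≈ y * pow R y (m ∸ suc j)
    pow-suc-∸ j<m = reflexive (cong (pow R y) (ℕ.+-∸-assoc 1 j<m))

  horner-[f-c]*g : ∀ y (f : ℕ → Carrier) c (g : ℕ → Carrier) m →
    horner y (λ k → (f k - c) * g k) m ≈ horner y (λ k → f k * g k) m - c * horner y g m
  horner-[f-c]*g y f c g m = begin
    horner y (λ k → (f k - c) * g k) m                    ≈⟨ sum1-cong m split ⟩
    sum1 R m (λ k → f k * g k * Y k + - c * (g k * Y k))  ≈⟨ sum1-+ m _ _ ⟩
    horner y (λ k → f k * g k) m + sum1 R m (λ k → - c * (g k * Y k)) ≈⟨ +-congˡ (sum1-*ˡ m (- c) _) ⟩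
    horner y (λ k → f k * g k) m + - c * horner y g m     ≈⟨ +-congˡ (-‿distribˡ-* c _) ⟨
    horner y (λ k → f k * g k) m - c * horner y g m       ∎
    where
    Y : ℕ → Carrier
    Y k = pow R y (m ∸ k)
    split : ∀ k → (f k - c) * g k * Y k ≈ f k * g k * Y k + - c * (g k * Y k)
    split k = trans (*-congʳ (distribʳ (g k) (f k) (- c))) (trans (distribʳ _ _ _) (+-congˡ (*-assoc _ _ _)))

  module BinomialSums (x : Carrier) where

    binomialSum : (ℕ → Carrier) → ℕ → Carrier
    binomialSum g m = sum1 R m (λ k → (m C k) × 1# * g k * pow R x k)

    shiftedBinomialSum : (ℕ → Carrier) → ℕ → Carrier
    shiftedBinomialSum g m = sum1 R (suc m) (λ k → (m C (k ∸ 1)) × 1# * g k * pow R x k)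

    binomialSum-*ˡ : ∀ z (g : ℕ → Carrier) m → binomialSum (λ k → z * g k) m ≈ z * binomialSum g m
    binomialSum-*ˡ z g m = trans (sum1-cong m (λ k → *-congʳ (x∙yz≈y∙xz _ z _))) (trans (sum1-cong m (λ k → *-assoc z _ _)) (sum1-*ˡ m z _))

    shiftedBinomialSum-cong : ∀ {g g′} m → (∀ j → g (suc j) ≈ g′ (suc j)) → shiftedBinomialSum g m ≈ shiftedBinomialSum g′ m
    shiftedBinomialSum-cong m g≈g′ = sum1-cong-on (suc m) (λ j _ → *-congʳ (*-congˡ (g≈g′ j)))

    binomialSum-suc : ∀ g m → binomialSum g (suc m) ≈ binomialSum g m + shiftedBinomialSum g m
    binomialSum-suc g m = begin
      binomialSum g (suc m)                            ≈⟨ sum1-cong-on (suc m) (λ j _ → pascal j) ⟩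
      sum1 R (suc m) (λ k → shifted k + unshifted k)   ≈⟨ sum1-+ (suc m) shifted unshifted ⟩
      shiftedBinomialSum g m + sum1 R (suc m) unshifted ≈⟨ +-comm _ _ ⟩
      sum1 R m unshifted + unshifted (suc m) + shiftedBinomialSum g m
        ≈⟨ +-congʳ (trans (+-congˡ vanishing) (+-identityʳ _)) ⟩
      binomialSum g m + shiftedBinomialSum g m          ∎
      where
      shifted unshifted : ℕ → Carrier
      shifted   k = (m C (k ∸ 1)) × 1# * g k * pow R x k
      unshifted k = (m C k) × 1# * g k * pow R x k
      pascal : ∀ j → (suc m C suc j) × 1# * g (suc j) * pow R x (suc j) ≈ shifted (suc j) + unshifted (suc j)
      pascal j = begin
        (suc m C suc j) × 1# * g (suc j) * pow R x (suc j)
          ≈⟨ *-congʳ (*-congʳ (reflexive (cong (_× 1#) (nCk+nC[k+1]≡[n+1]C[k+1] m j)))) ⟨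
        (m C j ℕ.+ m C suc j) × 1# * g (suc j) * pow R x (suc j)
          ≈⟨ *-congʳ (*-congʳ (×-homo-+ 1# (m C j) (m C suc j))) ⟩
        ((m C j) × 1# + (m C suc j) × 1#) * g (suc j) * pow R x (suc j)
          ≈⟨ trans (*-congʳ (distribʳ _ _ _)) (distribʳ _ _ _) ⟩
        shifted (suc j) + unshifted (suc j) ∎
      vanishing : unshifted (suc m) ≈ 0#
      vanishing = begin
        (m C suc m) × 1# * g (suc m) * pow R x (suc m) ≈⟨ *-congʳ (*-congʳ (reflexive (cong (_× 1#) (k>n⇒nCk≡0 {m} ℕ.≤-refl)))) ⟩
        0# * g (suc m) * pow R x (suc m)               ≈⟨ trans (*-congʳ (zeroˡ _)) (zeroˡ _) ⟩
        0#                                             ∎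

    shiftedBinomialSum-pred : ∀ g m → shiftedBinomialSum (λ k → g (k ∸ 1)) m ≈ x * g 0 + x * binomialSum g m
    shiftedBinomialSum-pred g m = trans (sum1-suc-first m _) (+-cong first (trans (sum1-cong m shift) (sum1-*ˡ m x _)))
      where
      -- the k = 1 term, where (m C 0) × 1# computes to 1# + 0#
      first : (1# + 0#) * g 0 * (x * 1#) ≈ x * g 0
      first = trans (*-cong (trans (*-congʳ (+-identityʳ 1#)) (*-identityˡ _)) (*-identityʳ x)) (*-comm _ _)
      shift : ∀ j → (m C j) × 1# * g j * (x * pow R x j) ≈ x * ((m C j) × 1# * g j * pow R x j)
      shift j = x∙yz≈y∙xz _ x _

    shiftedBinomialSum-split : ∀ g g′ m →
      shiftedBinomialSum g m ≈ shiftedBinomialSum (λ k → g k - g′ k) m + shiftedBinomialSum g′ m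
    shiftedBinomialSum-split g g′ m = trans (sum1-cong (suc m) split) (sum1-+ (suc m) _ _)
      where
      split : ∀ k → (m C (k ∸ 1)) × 1# * g k * pow R x k
                  ≈ (m C (k ∸ 1)) × 1# * (g k - g′ k) * pow R x k + (m C (k ∸ 1)) × 1# * g′ k * pow R x k
      split k = begin
        _ ≈⟨ *-congʳ (*-congˡ (//-rightDividesˡ (g′ k) (g k))) ⟨
        (m C (k ∸ 1)) × 1# * (g k - g′ k + g′ k) * pow R x k ≈⟨ trans (*-congʳ (distribˡ _ _ _)) (distribʳ _ _ _) ⟩
        _ ∎

    binomialSum-suc-Δ : ∀ g m → binomialSum g (suc m)
      ≈ (1# + x) * binomialSum g m + x * g 0 + shiftedBinomialSum (λ k → g k - g (k ∸ 1)) m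
    binomialSum-suc-Δ g m = begin
      binomialSum g (suc m)                      ≈⟨ binomialSum-suc g m ⟩
      T + shiftedBinomialSum g m                 ≈⟨ +-congˡ (shiftedBinomialSum-split g (λ k → g (k ∸ 1)) m) ⟩
      T + (D + shiftedBinomialSum (λ k → g (k ∸ 1)) m) ≈⟨ +-congˡ (+-congˡ (shiftedBinomialSum-pred g m)) ⟩
      T + (D + (x * g 0 + x * T))                ≈⟨ trans (+-congˡ (+-comm _ _)) (sym (+-assoc _ _ _)) ⟩
      T + (x * g 0 + x * T) + D                  ≈⟨ +-congʳ (x∙yz≈xz∙y T _ _) ⟩
      T + x * T + x * g 0 + D                    ≈⟨ +-congʳ (+-congʳ (+-congʳ (*-identityˡ T))) ⟨
      1# * T + x * T + x * g 0 + D               ≈⟨ +-congʳ (+-congʳ (distribʳ T 1# x)) ⟨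
      (1# + x) * T + x * g 0 + D                 ∎
      where
      T = binomialSum g m
      D = shiftedBinomialSum (λ k → g k - g (k ∸ 1)) m

module HarmonicSums {c ℓ : Level} (R : CommutativeRing c ℓ) (φ : ℚ → CommutativeRing.Carrier R)
         (φ-hom : IsRingHomomorphism +-*-rawRing (CommutativeRing.rawRing R) φ) where
  open CommutativeRing R
  open IsRingHomomorphism φ-hom
  open import Relation.Binary.Reasoning.Setoid setoid
  open import Algebra.Properties.Semiring.Mult semiring using (_×_; ×1-homo-*)
  open import Algebra.Solver.Ring.AlmostCommutativeRing
    using (_-Raw-AlmostCommutative⟶_; fromCommutativeRing)
  open import Data.Maybe using (Maybe; just; nothing)
  open import Relation.Nullary using (yes; no)

  -- The solver evaluates a constant q as ψ q; ψ agrees with φ but computes to the ring's own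
  -- 0# and 1# on 0ℚ and 1ℚ, so that solver expressions match goals written with 0# and 1#.
  private
    ψ : ℚ → Carrier
    ψ q with q ℚ.≟ ℚ.1ℚ
    ... | yes _ = 1#
    ... | no _ with q ℚ.≟ ℚ.0ℚ
    ...   | yes _ = 0#
    ...   | no _ = φ q

    ψ≈φ : ∀ q → ψ q ≈ φ q
    ψ≈φ q with q ℚ.≟ ℚ.1ℚ
    ... | yes ≡.refl = sym 1#-homo
    ... | no _ with q ℚ.≟ ℚ.0ℚ
    ...   | yes ≡.refl = sym 0#-homo
    ...   | no _ = refl

    ψ-morphism : +-*-rawRing -Raw-AlmostCommutative⟶ fromCommutativeRing R
    ψ-morphism = record
      { ⟦_⟧    = ψ
      ; +-homo = λ p q → trans (ψ≈φ _) (trans (+-homo p q) (sym (+-cong (ψ≈φ p) (ψ≈φ q))))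
      ; *-homo = λ p q → trans (ψ≈φ _) (trans (*-homo p q) (sym (*-cong (ψ≈φ p) (ψ≈φ q))))
      ; -‿homo = λ p → trans (ψ≈φ _) (trans (-‿homo p) (sym (-‿cong (ψ≈φ p))))
      ; 0-homo = trans (ψ≈φ _) 0#-homo
      ; 1-homo = refl
      }

    ψ-≟ : ∀ p q → Maybe (ψ p ≈ ψ q)
    ψ-≟ p q with p ℚ.≟ q
    ... | yes ≡.refl = just refl
    ... | no _       = nothing

  open import Algebra.Solver.Ring +-*-rawRing (fromCommutativeRing R) ψ-morphism ψ-≟

  private
    :0 :1 : ∀ {n} → Polynomial n
    :0 = con ℚ.0ℚ
    :1 = con ℚ.1ℚ

  φ-ℕtoℚ : ∀ m → φ (ℕtoℚ m) ≈ m × 1#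
  φ-ℕtoℚ zero    = 0#-homo
  φ-ℕtoℚ (suc m) = trans (⟦⟧-cong (ℕtoℚ-suc m)) (trans (+-homo _ _) (+-cong 1#-homo (φ-ℕtoℚ m)))

  r h h₂ s : ℕ → Carrier
  r k  = φ (inv k)
  h k  = φ (H k)
  h₂ k = φ (H^ 2 k)
  s k  = h k * h k + h₂ k

  inverse-unique : ∀ {u v a} → u * a ≈ 1# → v * a ≈ 1# → u ≈ v
  inverse-unique {u} {v} {a} ua≈1 va≈1 = begin
    u           ≈⟨ *-identityʳ u ⟨
    u * 1#      ≈⟨ *-congˡ va≈1 ⟨
    u * (v * a) ≈⟨ solve 3 (λ u v a → u :* (v :* a) := (u :* a) :* v) refl u v a ⟩
    u * a * v   ≈⟨ *-congʳ ua≈1 ⟩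
    1# * v      ≈⟨ *-identityˡ v ⟩
    v           ∎

  cross-multiplication : ∀ {α β u v a b} → u * a ≈ 1# → v * b ≈ 1# → α * b ≈ β * a → α * u ≈ β * v
  cross-multiplication {α} {β} {u} {v} {a} {b} ua≈1 vb≈1 αb≈βa = begin
    α * u                 ≈⟨ *-identityʳ _ ⟨
    α * u * 1#            ≈⟨ *-congˡ vb≈1 ⟨
    α * u * (v * b)       ≈⟨ solve 4 (λ α u v b → α :* u :* (v :* b) := α :* b :* (u :* v)) refl α u v b ⟩
    α * b * (u * v)       ≈⟨ *-congʳ αb≈βa ⟩
    β * a * (u * v)       ≈⟨ solve 4 (λ β a u v → β :* a :* (u :* v) := β :* v :* (u :* a)) refl β a u v ⟩
    β * v * (u * a)       ≈⟨ *-congˡ ua≈1 ⟩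
    β * v * 1#            ≈⟨ *-identityʳ _ ⟩
    β * v                 ∎


  φ[1/[1+d]]*[1+d]≈1 : ∀ d → φ ((+ 1) / suc d) * (suc d × 1#) ≈ 1#
  φ[1/[1+d]]*[1+d]≈1 d = begin
    φ ((+ 1) / suc d) * (suc d × 1#)         ≈⟨ *-congˡ (φ-ℕtoℚ (suc d)) ⟨
    φ ((+ 1) / suc d) * φ (ℕtoℚ (suc d))     ≈⟨ *-homo _ _ ⟨
    φ ((+ 1) / suc d ℚ.* ℕtoℚ (suc d))       ≈⟨ ⟦⟧-cong (1/[1+d]*[1+d]≡1 d) ⟩
    φ ℚ.1ℚ                                   ≈⟨ 1#-homo ⟩
    1#                                       ∎

  C-absorb : ∀ m j → (m C j) × 1# * r (suc j) ≈ (suc m C suc j) × 1# * r (suc m)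
  C-absorb m j = cross-multiplication (φ[1/[1+d]]*[1+d]≈1 j) (φ[1/[1+d]]*[1+d]≈1 m) (begin
    (m C j) × 1# * (suc m × 1#)          ≈⟨ *-comm _ _ ⟩
    (suc m × 1#) * (m C j) × 1#          ≈⟨ ×1-homo-* (suc m) (m C j) ⟨
    (suc m ℕ.* (m C j)) × 1#             ≈⟨ reflexive (cong (_× 1#) ([k+1]*[n+1]C[k+1]≡[n+1]*nCk m j)) ⟨
    (suc j ℕ.* (suc m C suc j)) × 1#     ≈⟨ ×1-homo-* (suc j) (suc m C suc j) ⟩
    (suc j × 1#) * (suc m C suc j) × 1#  ≈⟨ *-comm _ _ ⟩
    (suc m C suc j) × 1# * (suc j × 1#)  ∎)

  φ[H²+H⁽²⁾]≈s : ∀ k → φ (H k ℚ.* H k ℚ.+ H^ 2 k) ≈ s k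
  φ[H²+H⁽²⁾]≈s k = trans (+-homo _ _) (+-congʳ (*-homo _ _))

  h-zero : h 0 ≈ 0#
  h-zero = 0#-homo

  s-zero : s 0 ≈ 0#
  s-zero = trans (+-cong (*-cong h-zero h-zero) 0#-homo) (solve 0 (:0 :* :0 :+ :0 := :0) refl)

  h-suc : ∀ m → h (suc m) ≈ h m + r (suc m)
  h-suc m = trans (⟦⟧-cong (H-suc m)) (+-homo _ _)

  h₂-suc : ∀ m → h₂ (suc m) ≈ h₂ m + r (suc m) * r (suc m)
  h₂-suc m = trans (⟦⟧-cong (H²-suc m)) (trans (+-homo _ _) (+-congˡ (inverse-unique
    (φ[1/[1+d]]*[1+d]≈1 (m ℕ.+ m ℕ.* suc m))
    (begin
      ρ * ρ * (suc m ℕ.* suc m) × 1#         ≈⟨ *-congˡ (×1-homo-* (suc m) (suc m)) ⟩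
      ρ * ρ * ((suc m × 1#) * (suc m × 1#))  ≈⟨ solve 2 (λ ρ d → ρ :* ρ :* (d :* d) := (ρ :* d) :* (ρ :* d)) refl ρ (suc m × 1#) ⟩
      ρ * (suc m × 1#) * (ρ * (suc m × 1#))  ≈⟨ *-cong (φ[1/[1+d]]*[1+d]≈1 m) (φ[1/[1+d]]*[1+d]≈1 m) ⟩
      1# * 1#                                ≈⟨ *-identityˡ 1# ⟩
      1#                                     ∎))))
    where ρ = r (suc m)

  s-suc : ∀ m → s (suc m) ≈ s m + 2 × 1# * (h (suc m) * r (suc m))
  s-suc m = begin
    h (suc m) * h (suc m) + h₂ (suc m)                ≈⟨ +-cong (*-cong (h-suc m) (h-suc m)) (h₂-suc m) ⟩
    (h m + ρ) * (h m + ρ) + (h₂ m + ρ * ρ)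
      ≈⟨ solve 3 (λ a b ρ → (a :+ ρ) :* (a :+ ρ) :+ (b :+ ρ :* ρ) := a :* a :+ b :+ 2 :× :1 :* ((a :+ ρ) :* ρ)) refl (h m) (h₂ m) ρ ⟩
    s m + 2 × 1# * ((h m + ρ) * ρ)                    ≈⟨ +-congˡ (*-congˡ (*-congʳ (h-suc m))) ⟨
    s m + 2 × 1# * (h (suc m) * ρ)                    ∎
    where ρ = r (suc m)

  module _ (x : Carrier) where
    open BinomialSums R x

    private
      y : Carrier
      y = 1# + x

    shiftedBinomialSum-r : ∀ f m → shiftedBinomialSum (λ k → r k * f k) m ≈ r (suc m) * binomialSum f (suc m)
    shiftedBinomialSum-r f m = trans (sum1-cong-on R (suc m) (λ j _ → absorb j)) (sum1-*ˡ R (suc m) (r (suc m)) _)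
      where
      absorb : ∀ j → (m C j) × 1# * (r (suc j) * f (suc j)) * pow R x (suc j)
                   ≈ r (suc m) * ((suc m C suc j) × 1# * f (suc j) * pow R x (suc j))
      absorb j = begin
        (m C j) × 1# * (r (suc j) * f (suc j)) * pow R x (suc j)  ≈⟨ *-congʳ (*-assoc _ _ _) ⟨
        (m C j) × 1# * r (suc j) * f (suc j) * pow R x (suc j)    ≈⟨ *-congʳ (*-congʳ (C-absorb m j)) ⟩
        (suc m C suc j) × 1# * r (suc m) * f (suc j) * pow R x (suc j)
          ≈⟨ solve 4 (λ c ρ a b → c :* ρ :* a :* b := ρ :* (c :* a :* b)) refl _ (r (suc m)) (f (suc j)) _ ⟩
        r (suc m) * ((suc m C suc j) × 1# * f (suc j) * pow R x (suc j)) ∎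

    binomialSum-one : ∀ m → binomialSum (λ _ → 1#) m ≈ pow R y m - 1#
    binomialSum-one zero    = solve 0 (:0 := :1 :- :1) refl
    binomialSum-one (suc m) = begin
      binomialSum (λ _ → 1#) (suc m)                               ≈⟨ binomialSum-suc _ m ⟩
      binomialSum (λ _ → 1#) m + shiftedBinomialSum (λ _ → 1#) m  ≈⟨ +-cong IH (trans (shiftedBinomialSum-pred _ m) (+-congˡ (*-congˡ IH))) ⟩
      (pow R y m - 1#) + (x * 1# + x * (pow R y m - 1#))
        ≈⟨ solve 2 (λ x p → (p :- :1) :+ (x :* :1 :+ x :* (p :- :1)) := (:1 :+ x) :* p :- :1) refl x (pow R y m) ⟩
      pow R y (suc m) - 1#                                          ∎
      where IH = binomialSum-one m

    binomialSum-h : ∀ m → binomialSum h m ≈ h m * pow R y m - horner R y r m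
    binomialSum-h zero    = trans (solve 0 (:0 := :0 :* :1 :- :0) refl) (+-congʳ (*-congʳ (sym h-zero)))
    binomialSum-h (suc m) = begin
      binomialSum h (suc m)                                        ≈⟨ binomialSum-suc-Δ h m ⟩
      y * binomialSum h m + x * h 0 + shiftedBinomialSum (λ k → h k - h (k ∸ 1)) m
        ≈⟨ +-cong (+-cong (*-congˡ (binomialSum-h m)) (*-congˡ h-zero)) differences ⟩
      y * (h m * pow R y m - V) + x * 0# + ρ * (y * pow R y m - 1#)
        ≈⟨ solve 6 (λ x y p a v ρ → y :* (a :* p :- v) :+ x :* :0 :+ ρ :* (y :* p :- :1)
                                   := (a :+ ρ) :* (y :* p) :- (y :* v :+ ρ)) refl x y (pow R y m) (h m) V ρ ⟩
      (h m + ρ) * pow R y (suc m) - (y * V + ρ)                    ≈⟨ +-cong (*-congʳ (h-suc m)) (-‿cong (horner-suc R y r m)) ⟨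
      h (suc m) * pow R y (suc m) - horner R y r (suc m)           ∎
      where
      ρ = r (suc m)
      V = horner R y r m
      difference : ∀ j → h (suc j) - h j ≈ r (suc j) * 1#
      difference j = trans (+-congʳ (h-suc j)) (solve 2 (λ a ρ → a :+ ρ :- a := ρ :* :1) refl (h j) (r (suc j)))
      differences : shiftedBinomialSum (λ k → h k - h (k ∸ 1)) m ≈ ρ * (y * pow R y m - 1#)
      differences = trans (shiftedBinomialSum-cong m difference)
                    (trans (shiftedBinomialSum-r (λ _ → 1#) m) (*-congˡ (binomialSum-one (suc m))))

    binomialSum-s : ∀ m → binomialSum s m
      ≈ pow R y m * s m + 2 × 1# * (horner R y (λ k → h (k ∸ 1) * r k) m - h m * horner R y r m)
    binomialSum-s zero    = trans (solve 0 (:0 := :1 :* :0 :+ 2 :× :1 :* (:0 :- :0 :* :0)) refl)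
      (sym (+-cong (*-congˡ s-zero) (*-congˡ (+-congˡ (-‿cong (*-congʳ h-zero))))))
    binomialSum-s (suc m) = begin
      binomialSum s (suc m)                                        ≈⟨ binomialSum-suc-Δ s m ⟩
      y * binomialSum s m + x * s 0 + shiftedBinomialSum (λ k → s k - s (k ∸ 1)) m
        ≈⟨ +-cong (+-cong (*-congˡ (binomialSum-s m)) (*-congˡ s-zero)) differences ⟩
      y * (pow R y m * s m + 2 × 1# * (P - h m * V)) + x * 0#
        + ρ * (2 × 1# * ((h m + ρ) * (y * pow R y m) - (y * V + ρ)))
        ≈⟨ solve 8 (λ x y p b P a V ρ →
               y :* (p :* b :+ 2 :× :1 :* (P :- a :* V)) :+ x :* :0 :+ ρ :* (2 :× :1 :* ((a :+ ρ) :* (y :* p) :- (y :* V :+ ρ)))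
            := y :* p :* (b :+ 2 :× :1 :* ((a :+ ρ) :* ρ)) :+ 2 :× :1 :* ((y :* P :+ a :* ρ) :- (a :+ ρ) :* (y :* V :+ ρ)))
            refl x y (pow R y m) (s m) P (h m) V ρ ⟩
      pow R y (suc m) * (s m + 2 × 1# * ((h m + ρ) * ρ)) + 2 × 1# * ((y * P + h m * ρ) - (h m + ρ) * (y * V + ρ))
        ≈⟨ +-cong (*-congˡ s-step) (*-congˡ (+-cong (horner-suc R y _ m) (-‿cong (*-cong (h-suc m) (horner-suc R y r m))))) ⟨
      pow R y (suc m) * s (suc m) + 2 × 1# * (horner R y (λ k → h (k ∸ 1) * r k) (suc m) - h (suc m) * horner R y r (suc m)) ∎
      where
      ρ = r (suc m)
      V = horner R y r m
      P = horner R y (λ k → h (k ∸ 1) * r k) m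
      s-step : s (suc m) ≈ s m + 2 × 1# * ((h m + ρ) * ρ)
      s-step = trans (s-suc m) (+-congˡ (*-congˡ (*-congʳ (h-suc m))))
      difference : ∀ j → s (suc j) - s j ≈ r (suc j) * (2 × 1# * h (suc j))
      difference j = trans (+-congʳ (s-suc j))
        (solve 3 (λ b a ρ → b :+ 2 :× :1 :* (a :* ρ) :- b := ρ :* (2 :× :1 :* a)) refl (s j) (h (suc j)) (r (suc j)))
      differences : shiftedBinomialSum (λ k → s k - s (k ∸ 1)) m
                    ≈ ρ * (2 × 1# * ((h m + ρ) * (y * pow R y m) - (y * V + ρ)))
      differences = begin
        shiftedBinomialSum (λ k → s k - s (k ∸ 1)) m              ≈⟨ shiftedBinomialSum-cong m difference ⟩
        shiftedBinomialSum (λ k → r k * (2 × 1# * h k)) m         ≈⟨ shiftedBinomialSum-r _ m ⟩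
        ρ * binomialSum (λ k → 2 × 1# * h k) (suc m)              ≈⟨ *-congˡ (binomialSum-*ˡ _ h (suc m)) ⟩
        ρ * (2 × 1# * binomialSum h (suc m))                      ≈⟨ *-congˡ (*-congˡ (binomialSum-h (suc m))) ⟩
        ρ * (2 × 1# * (h (suc m) * pow R y (suc m) - horner R y r (suc m)))
          ≈⟨ *-congˡ (*-congˡ (+-cong (*-congʳ (h-suc m)) (-‿cong (horner-suc R y r m)))) ⟩
        ρ * (2 × 1# * ((h m + ρ) * (y * pow R y m) - (y * V + ρ))) ∎

mainTheorem15 : {c ℓ : Level} (R : CommutativeRing c ℓ)
    → (φ : ℚ → CommutativeRing.Carrier R)
    → IsRingHomomorphism +-*-rawRing (CommutativeRing.rawRing R) φ
    → (n : ℕ) (x : CommutativeRing.Carrier R)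
    → let open CommutativeRing R in
      sum1 R n (λ k → φ (ℕtoℚ (n C k)) * φ (H k ℚ.* H k ℚ.+ H^ 2 k) * pow R x k)
      ≈ pow R (1# + x) n * φ (H n ℚ.* H n ℚ.+ H^ 2 n)
        + φ (ℕtoℚ 2) * sum1 R n (λ k → φ ((H (k ∸ 1) ℚ.- H n) ℚ.* inv k) * pow R (1# + x) (n ∸ k))
mainTheorem15 R φ φ-hom n x = begin
  sum1 R n (λ k → φ (ℕtoℚ (n C k)) * φ (H k ℚ.* H k ℚ.+ H^ 2 k) * pow R x k)
    ≈⟨ sum1-cong R n (λ k → *-congʳ (*-cong (φ-ℕtoℚ (n C k)) (φ[H²+H⁽²⁾]≈s k))) ⟩
  binomialSum s n
    ≈⟨ binomialSum-s x n ⟩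
  pow R y n * s n + 2 × 1# * (horner R y (λ k → h (k ∸ 1) * r k) n - h n * horner R y r n)
    ≈⟨ +-cong (*-congˡ (φ[H²+H⁽²⁾]≈s n))
              (*-cong (φ-ℕtoℚ 2) (trans (sum1-cong R n (λ k → *-congʳ (φ-term k))) (horner-[f-c]*g R y _ (h n) r n))) ⟨
  pow R y n * φ (H n ℚ.* H n ℚ.+ H^ 2 n) + φ (ℕtoℚ 2) * sum1 R n (λ k → φ ((H (k ∸ 1) ℚ.- H n) ℚ.* inv k) * pow R y (n ∸ k)) ∎
  where
  open CommutativeRing R
  open IsRingHomomorphism φ-hom
  open HarmonicSums R φ φ-hom
  open BinomialSums R x
  open import Relation.Binary.Reasoning.Setoid setoid
  open import Algebra.Properties.Semiring.Mult semiring using (_×_)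
  y : Carrier
  y = 1# + x
  φ-term : ∀ k → φ ((H (k ∸ 1) ℚ.- H n) ℚ.* inv k) ≈ (h (k ∸ 1) - h n) * r k
  φ-term k = trans (*-homo _ _) (*-congʳ (trans (+-homo _ _) (+-congˡ (-‿homo _))))
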